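{- Let $G$ be a graph and let $\mathcal{P} = \{V_1, \dots, V_k\}$ be a partition of $V(G)$ such that $|V_i| > 2 \Delta(G)$ for all $i \in [k-1]$. Then for any $v_k, v_k' \in V_k$, there exists an independent transversal $T$ of $\{V_1, \dots, V_{k-1}\}$ (in the graph $G[V_1 \cup \dots \cup V_{k-1}]$) such that both $T \cup \{v_k\}$ and $T \cup \{v_k'\}$ are independent transversals of $\mathcal{P}$.
   Context: Given a graph $G$ and a partition $\mathcal{Q} = \{W_1, \dots, W_m\}$ of a vertex set $W \subseteq V(G)$, a transversal of $\mathcal{Q}$ is a set containing exactly one vertex from each $W_i$; an independent transversal of $\mathcal{Q}$ is a transversal which is an independent set in $G$. $\Delta(G)$ denotes the maximum degree of $G$. -}

module Defs where

open import Data.Nat using (ℕ; zero; suc; _+_; _⊔_)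
open import Data.Bool using (Bool; true; false; if_then_else_)
open import Data.Fin using (Fin; zero; suc; _≟_)
open import Data.List using (List; map; foldr; allFin)
open import Data.Nat.ListAction using (sum)
open import Data.Product using (_×_)
open import Relation.Nullary using (does)
open import Relation.Binary.PropositionalEquality using (_≡_)

record Graph (n : ℕ) : Set where
  field
    adj    : Fin n → Fin n → Bool
    sym    : ∀ u v → adj u v ≡ adj v u
    irrefl : ∀ v → adj v v ≡ false
open Graph public

countB : ∀ {n} → (Fin n → Bool) → ℕ
countB {n} p = sum (map (λ u → if p u then 1 else 0) (allFin n))

degree : ∀ {n} → Graph n → Fin n → ℕ
degree G v = countB (adj G v)

Δ : ∀ {n} → Graph n → ℕ
Δ {n} G = foldr _⊔_ 0 (map (degree G) (allFin n))

-- A partition of V(G) into k (labelled) parts V_0..V_{k-1} is a map part : Fin n → Fin k;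
-- V_i = { v | part v ≡ i }.  Its size:
partSize : ∀ {n k} → (Fin n → Fin k) → Fin k → ℕ
partSize part i = countB (λ v → does (part v ≟ i))

-- A transversal of the family of parts indexed by ι : Fin j → Fin k,
-- given as a choice function t with t a ∈ V_(ι a).
IsTransversal : ∀ {n k j} → (Fin n → Fin k) → (Fin j → Fin k) → (Fin j → Fin n) → Set
IsTransversal part ι t = ∀ a → part (t a) ≡ ι a

IsIndependent : ∀ {n j} → Graph n → (Fin j → Fin n) → Set
IsIndependent G t = ∀ a b → adj G (t a) (t b) ≡ false

IsIndependentTransversal : ∀ {n k j} → Graph n → (Fin n → Fin k) → (Fin j → Fin k) → (Fin j → Fin n) → Set
IsIndependentTransversal G part ι t = IsTransversal part ι t × IsIndependent G t

-- T ∪ {v}: extend a choice function on Fin m by v at the last index fromℕ m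
extend : ∀ {n m} → (Fin m → Fin n) → Fin n → Fin (suc m) → Fin n
extend {m = zero}  t v zero    = v
extend {m = suc m} t v zero    = t zero
extend {m = suc m} t v (suc i) = extend (λ a → t (suc a)) v i

module Submission where

-- Lemma 2.1 follows from a version of Haxell's theorem with a forbidden vertex set:
-- if every part has more than 2Δ vertices and at most 2Δ vertices are forbidden, there is an
-- independent transversal avoiding them.  Forbidding N(v) ∪ N(v′), both extensions by v and v′
-- remain independent.
--
-- Haxell's theorem is proved by extending a partial independent transversal M one part r at a
-- time.  The search keeps an alternating tree of edges (x , y): x is a vertex of a part spanned
-- by the older edges (the root r or the part of an older y) that is not blocked (neither
-- forbidden nor adjacent to a tree vertex), and y ∈ M is a neighbour of x.  Counting shows that
-- an unblocked vertex in a spanned part always exists: t edges block at most 2Δ(t+1) vertices,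
-- but span t+1 distinct parts of more than 2Δ vertices each.  If that vertex is free of M it
-- fills r or replaces some y, lowering the number of M-neighbours of the corresponding x;
-- otherwise the tree grows.  These counts decrease lexicographically along the tree, and the
-- tree has fewer than n edges, so the search terminates.

open import Defs hiding (sym)
open import Data.Nat using (ℕ; zero; suc; _+_; _*_; _≤_; _<_; _⊔_; z≤n; s≤s)
open import Data.Nat.Properties hiding (_≟_)
open import Data.Bool using (Bool; true; false; if_then_else_; _∨_)
open import Data.Bool.Properties using (∨-conicalˡ; ∨-conicalʳ; ¬-not) renaming (_≟_ to _≟ᵇ_)
open import Data.Fin using (Fin; zero; suc; _≟_; inject₁; fromℕ)
open import Data.Fin.Properties using (any?)
open import Data.Maybe using (Maybe; just; nothing)
open import Data.Maybe.Properties using (just-injective)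
open import Data.List using (List; []; _∷_; map; foldr; allFin; length)
open import Data.List.Properties using (length-tabulate)
open import Data.List.Membership.Propositional using (_∈_)
open import Data.List.Membership.Propositional.Properties using (∈-allFin)
open import Data.List.Relation.Unary.Any using (here; there)
open import Data.Nat.ListAction using (sum)
open import Data.Product using (Σ; _×_; _,_; proj₁; proj₂)
open import Data.Sum using (_⊎_; inj₁; inj₂)
open import Data.Empty using (⊥; ⊥-elim)
open import Data.Unit using (⊤; tt)
open import Relation.Nullary using (yes; no; does)
open import Relation.Binary.PropositionalEquality
open import Relation.Nullary.Decidable using (dec-true)

-- Number of list elements satisfying a Boolean predicate;
-- countB p from Defs is definitionally count p (allFin n).
count : ∀ {A : Set} → (A → Bool) → List A → ℕ
count p xs = sum (map (λ u → if p u then 1 else 0) xs)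

_⊆ᵇ_ : ∀ {A : Set} → (A → Bool) → (A → Bool) → Set
P ⊆ᵇ Q = ∀ u → P u ≡ true → Q u ≡ true

module _ {A : Set} where

  count-mono : ∀ {P Q : A → Bool} → P ⊆ᵇ Q → ∀ xs → count P xs ≤ count Q xs
  count-mono P⊆Q [] = z≤n
  count-mono {P} {Q} P⊆Q (x ∷ xs) with P x in p | Q x in q
  ... | true  | true  = s≤s (count-mono P⊆Q xs)
  ... | true  | false with () ← trans (sym (P⊆Q x p)) q
  ... | false | true  = m≤n⇒m≤1+n (count-mono P⊆Q xs)
  ... | false | false = count-mono P⊆Q xs

  count-mono-< : ∀ {P Q : A → Bool} → P ⊆ᵇ Q → ∀ xs u → u ∈ xs → P u ≡ false → Q u ≡ true →
                 count P xs < count Q xs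
  count-mono-< {P} {Q} P⊆Q (x ∷ xs) .x (here refl) p q rewrite p | q = s≤s (count-mono P⊆Q xs)
  count-mono-< {P} {Q} P⊆Q (x ∷ xs) u (there u∈xs) pu qu with P x in p | Q x in q
  ... | true  | true  = s≤s (count-mono-< P⊆Q xs u u∈xs pu qu)
  ... | true  | false with () ← trans (sym (P⊆Q x p)) q
  ... | false | true  = m≤n⇒m≤1+n (count-mono-< P⊆Q xs u u∈xs pu qu)
  ... | false | false = count-mono-< P⊆Q xs u u∈xs pu qu

  count-∨ : ∀ (P Q : A → Bool) xs → count (λ u → P u ∨ Q u) xs ≤ count P xs + count Q xs
  count-∨ P Q [] = z≤n
  count-∨ P Q (x ∷ xs) with P x | Q x
  ... | true  | true  = s≤s (≤-trans (m≤n⇒m≤1+n (count-∨ P Q xs)) (≤-reflexive (sym (+-suc _ _))))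
  ... | true  | false = s≤s (count-∨ P Q xs)
  ... | false | true  = ≤-trans (s≤s (count-∨ P Q xs)) (≤-reflexive (sym (+-suc _ _)))
  ... | false | false = count-∨ P Q xs

  count-∨-disjoint : ∀ (P Q : A → Bool) → (∀ u → P u ≡ true → Q u ≡ false) →
                     ∀ xs → count (λ u → P u ∨ Q u) xs ≡ count P xs + count Q xs
  count-∨-disjoint P Q disj [] = refl
  count-∨-disjoint P Q disj (x ∷ xs) with P x in p | Q x in q
  ... | true  | true  with () ← trans (sym (disj x p)) q
  ... | true  | false = cong suc (count-∨-disjoint P Q disj xs)
  ... | false | true  = trans (cong suc (count-∨-disjoint P Q disj xs)) (sym (+-suc _ _))
  ... | false | false = count-∨-disjoint P Q disj xs

  count≤length : ∀ (P : A → Bool) xs → count P xs ≤ length xs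
  count≤length P [] = z≤n
  count≤length P (x ∷ xs) with P x
  ... | true  = s≤s (count≤length P xs)
  ... | false = m≤n⇒m≤1+n (count≤length P xs)

  pigeonhole : ∀ (P Q : A → Bool) xs → count Q xs < count P xs → Σ A λ u → P u ≡ true × Q u ≡ false
  pigeonhole P Q (x ∷ xs) lt with P x in p | Q x in q
  ... | true  | false = x , p , q
  ... | true  | true  = pigeonhole P Q xs (≤-pred lt)
  ... | false | true  = pigeonhole P Q xs (<-trans (n<1+n _) lt)
  ... | false | false = pigeonhole P Q xs lt

countB≤ : ∀ {n} (P : Fin n → Bool) → countB P ≤ n
countB≤ {n} P = ≤-trans (count≤length P (allFin n)) (≤-reflexive (length-tabulate {n = n} (λ i → i)))

true≢false : true ≢ false
true≢false ()

≟-true : ∀ {k} {p q : Fin k} → does (p ≟ q) ≡ true → p ≡ q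
≟-true {p = p} {q} e with p ≟ q
... | yes p≡q = p≡q

find : ∀ {k} (P : Fin k → Bool) → (Σ (Fin k) λ i → P i ≡ true) ⊎ (∀ i → P i ≡ false)
find P with any? (λ i → P i ≟ᵇ true)
... | yes (i , e) = inj₁ (i , e)
... | no ¬e      = inj₂ λ i → ¬-not (λ e → ¬e (i , e))

degree≤Δ : ∀ {n} (G : Graph n) (v : Fin n) → degree G v ≤ Δ G
degree≤Δ {n} G v = ≤-max (allFin n) (∈-allFin v)
  where
  ≤-max : ∀ xs → v ∈ xs → degree G v ≤ foldr _⊔_ 0 (map (degree G) xs)
  ≤-max (_ ∷ xs) (here refl)  = m≤m⊔n _ _
  ≤-max (u ∷ xs) (there v∈xs) = ≤-trans (≤-max xs v∈xs) (m≤n⊔m (degree G u) _)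

module Haxell {n k : ℕ} (G : Graph n) (part : Fin n → Fin k)
              (forbidden : Fin n → Bool) (few : countB forbidden ≤ 2 * Δ G) where

  D : ℕ
  D = Δ G

  Big : Fin k → Set
  Big q = 2 * D < partSize part q

  Choice : Set
  Choice = Fin k → Maybe (Fin n)

  record Valid (M : Choice) : Set where
    field
      inPart      : ∀ {q u} → M q ≡ just u → part u ≡ q
      independent : ∀ {q q′ u w} → M q ≡ just u → M q′ ≡ just w → adj G u w ≡ false
      allowed     : ∀ {q u} → M q ≡ just u → forbidden u ≡ false
      bigPart     : ∀ {q u} → M q ≡ just u → Big q
  open Valid

  Filled : Choice → Fin k → Set
  Filled M q = Σ (Fin n) λ u → M q ≡ just u

  Extends : Choice → Choice → Set
  Extends M M′ = ∀ q → Filled M q → Filled M′ q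

  Free : Choice → Fin n → Set
  Free M x = ∀ {q u} → M q ≡ just u → adj G x u ≡ false

  Blocker : Choice → Fin n → Fin n → Set
  Blocker M x y = M (part y) ≡ just y × adj G x y ≡ true

  adjTo : Fin n → Maybe (Fin n) → Bool
  adjTo x nothing  = false
  adjTo x (just u) = adj G x u

  -- Number of parts whose chosen vertex is adjacent to x; the potential driving the search.
  conflicts : Choice → Fin n → ℕ
  conflicts M x = countB (λ q → adjTo x (M q))

  blocker : ∀ {M} → Valid M → ∀ x → (Σ (Fin n) λ y → Blocker M x y) ⊎ Free M x
  blocker {M} V x with find (λ q → adjTo x (M q))
  ... | inj₂ none = inj₂ λ {q} Mq → subst (λ o → adjTo x o ≡ false) Mq (none q)
  ... | inj₁ (q , xq) with M q in Mq
  ...   | just y = inj₁ (y , subst (λ p → M p ≡ just y) (sym (inPart V Mq)) Mq , xq)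

  assign : Choice → Fin k → Fin n → Choice
  assign M q x p with p ≟ q
  ... | yes _ = just x
  ... | no  _ = M p

  assign-at : ∀ {M q x} → assign M q x q ≡ just x
  assign-at {q = q} with q ≟ q
  ... | yes _   = refl
  ... | no  q≢q = ⊥-elim (q≢q refl)

  assign-other : ∀ {M q x p} → p ≢ q → assign M q x p ≡ M p
  assign-other {q = q} {p = p} p≢q with p ≟ q
  ... | yes p≡q = ⊥-elim (p≢q p≡q)
  ... | no  _   = refl

  assigned : ∀ {M q x p u} → assign M q x p ≡ just u → (p ≡ q × x ≡ u) ⊎ M p ≡ just u
  assigned {q = q} {p = p} e with p ≟ q
  ... | yes p≡q = inj₁ (p≡q , just-injective e)
  ... | no  _   = inj₂ e

  assign-valid : ∀ {M q x} → Valid M → Free M x → forbidden x ≡ false → part x ≡ q → Big q →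
                 Valid (assign M q x)
  assign-valid {M} {q} {x} V free allowedx px bigq = record
    { inPart      = λ {p} e → inPart′ (view p e)
    ; independent = λ {p} {p′} e e′ → independent′ (view p e) (view p′ e′)
    ; allowed     = λ {p} e → allowed′ (view p e)
    ; bigPart     = λ {p} e → bigPart′ (view p e)
    }
    where
    view : ∀ p {u} → assign M q x p ≡ just u → (p ≡ q × x ≡ u) ⊎ M p ≡ just u
    view p = assigned {M} {q} {x} {p}
    inPart′ : ∀ {p u} → (p ≡ q × x ≡ u) ⊎ M p ≡ just u → part u ≡ p
    inPart′ (inj₁ (p≡q , refl)) = trans px (sym p≡q)
    inPart′ (inj₂ Mp)           = inPart V Mp
    independent′ : ∀ {p p′ u w} → (p ≡ q × x ≡ u) ⊎ M p ≡ just u → (p′ ≡ q × x ≡ w) ⊎ M p′ ≡ just w →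
                   adj G u w ≡ false
    independent′ (inj₁ (_ , refl)) (inj₁ (_ , refl)) = irrefl G x
    independent′ (inj₁ (_ , refl)) (inj₂ Mw)         = free Mw
    independent′ {u = u} (inj₂ Mu) (inj₁ (_ , refl)) = trans (Graph.sym G u x) (free Mu)
    independent′ (inj₂ Mu) (inj₂ Mw)                 = independent V Mu Mw
    allowed′ : ∀ {p u} → (p ≡ q × x ≡ u) ⊎ M p ≡ just u → forbidden u ≡ false
    allowed′ (inj₁ (_ , refl)) = allowedx
    allowed′ (inj₂ Mp)         = allowed V Mp
    bigPart′ : ∀ {p u} → (p ≡ q × x ≡ u) ⊎ M p ≡ just u → Big p
    bigPart′ (inj₁ (p≡q , _)) = subst Big (sym p≡q) bigq
    bigPart′ (inj₂ Mp)        = bigPart V Mp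

  assign-extends : ∀ {M q x} → Extends M (assign M q x)
  assign-extends {M} {q} {x} p (u , Mp) with p ≟ q
  ... | yes _ = x , refl
  ... | no  _ = u , Mp

  assign-⊆ : ∀ {M q x a} → adj G a x ≡ false → (λ p → adjTo a (assign M q x p)) ⊆ᵇ (λ p → adjTo a (M p))
  assign-⊆ {M} {q} {x} {a} ax p e with p ≟ q
  ... | yes _ = ⊥-elim (true≢false (trans (sym e) ax))
  ... | no  _ = e

  -- The search maintains an
  -- alternating tree: edges (x , y), newest first, where x is a vertex of a part spanned by
  -- the older edges that is not blocked by them, and y is the chosen vertex blocking x.
  module Extend (r : Fin k) (bigr : Big r) (M0 : Choice) where

    Tree : Set
    Tree = List (Fin n × Fin n)

    spans : Tree → Fin k → Bool
    spans []            q = does (q ≟ r)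
    spans ((x , y) ∷ T) q = does (q ≟ part y) ∨ spans T q

    blocked : Tree → Fin n → Bool
    blocked []            u = forbidden u
    blocked ((x , y) ∷ T) u = adj G x u ∨ (adj G y u ∨ blocked T u)

    Admissible : Tree → Fin n → Set
    Admissible T x = spans T (part x) ≡ true × blocked T x ≡ false

    IsTree : Choice → Tree → Set
    IsTree M []            = ⊤
    IsTree M ((x , y) ∷ T) = IsTree M T × Admissible T x × Blocker M x y

    blocked-x : ∀ x y T {u} → blocked ((x , y) ∷ T) u ≡ false → adj G x u ≡ false
    blocked-x x y T b = ∨-conicalˡ _ _ b

    blocked-y : ∀ x y T {u} → blocked ((x , y) ∷ T) u ≡ false → adj G y u ≡ false
    blocked-y x y T b = ∨-conicalˡ _ _ (∨-conicalʳ (adj G x _) _ b)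

    blocked-below : ∀ x y T {u} → blocked ((x , y) ∷ T) u ≡ false → blocked T u ≡ false
    blocked-below x y T b = ∨-conicalʳ (adj G y _) _ (∨-conicalʳ (adj G x _) _ b)

    blocked-forbidden : ∀ T {u} → blocked T u ≡ false → forbidden u ≡ false
    blocked-forbidden []            b = b
    blocked-forbidden ((x , y) ∷ T) b = blocked-forbidden T (blocked-below x y T b)

    record Ok (M : Choice) : Set where
      field
        valid     : Valid M
        rootEmpty : M r ≡ nothing
        extends   : Extends M0 M
    open Ok

    Done : Set
    Done = Σ Choice λ M → Valid M × Filled M r × Extends M0 M

    -- A new blocking vertex lies in a part not yet spanned: the root part is empty, and it
    -- cannot be an older blocking vertex y′, since x is adjacent to it but not to y′.
    fresh : ∀ {M T x y} → M r ≡ nothing → IsTree M T → Blocker M x y → blocked T x ≡ false →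
            spans T (part y) ≡ false
    fresh {M} {[]} {y = y} Mr _ (My , _) _ with part y ≟ r
    ... | yes y∈r = ⊥-elim (nothing≢just (trans (sym Mr) (subst (λ p → M p ≡ just y) y∈r My)))
      where
      nothing≢just : ∀ {u} → nothing ≢ just u
      nothing≢just ()
    ... | no  _   = refl
    fresh {M} {(a , b) ∷ T} {x} {y} Mr (tree , _ , (Mb , _)) (My , xy) bx with part y ≟ part b
    ... | yes same = ⊥-elim (true≢false (trans (sym xb) (trans (Graph.sym G x b) (blocked-y a b T bx))))
      where
      xb : adj G x b ≡ true
      xb = subst (λ w → adj G x w ≡ true) (just-injective (trans (sym My) (trans (cong M same) Mb))) xy
    ... | no  _    = fresh Mr tree (My , xy) (blocked-below a b T bx)

    -- Spanned parts are big: the root by assumption, the others because they are covered.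
    spanned-big : ∀ {M T q} → Valid M → IsTree M T → spans T q ≡ true → Big q
    spanned-big {T = []} {q} V _ s = subst Big (sym (≟-true s)) bigr
    spanned-big {T = (x , y) ∷ T} {q} V (tree , _ , (My , _)) s with q ≟ part y
    ... | yes q≡y = subst Big (sym q≡y) (bigPart V My)
    ... | no  _   = spanned-big V tree s

    -- Each tree vertex has at most Δ neighbours, and at most 2Δ vertices are forbidden.
    blocked-count : ∀ T → countB (blocked T) ≤ suc (length T) * (2 * D)
    blocked-count []            = ≤-trans few (m≤m+n (2 * D) 0)
    blocked-count ((x , y) ∷ T) = begin
        countB (blocked ((x , y) ∷ T))
      ≤⟨ count-∨ (adj G x) _ (allFin n) ⟩
        countB (adj G x) + countB (λ u → adj G y u ∨ blocked T u)
      ≤⟨ +-monoʳ-≤ (countB (adj G x)) (count-∨ (adj G y) (blocked T) (allFin n)) ⟩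
        countB (adj G x) + (countB (adj G y) + countB (blocked T))
      ≤⟨ +-mono-≤ (degree≤Δ G x) (+-mono-≤ (degree≤Δ G y) (blocked-count T)) ⟩
        D + (D + suc (length T) * (2 * D))
      ≡⟨ twice D _ ⟩
        2 * D + suc (length T) * (2 * D)
      ∎
      where
      open ≤-Reasoning
      twice : ∀ d c → d + (d + c) ≡ 2 * d + c
      twice d c = sym (trans (+-assoc d (d + 0) c) (cong (λ z → d + (z + c)) (+-identityʳ d)))

    -- The spanned parts are pairwise distinct and each has more than 2Δ vertices.
    spanned-size : ∀ {M T} → Ok M → IsTree M T → suc (length T) * suc (2 * D) ≤ countB (λ u → spans T (part u))
    spanned-size {T = []}            ok _ = ≤-trans (≤-reflexive (+-identityʳ _)) bigr
    spanned-size {M} {(x , y) ∷ T} ok (tree , (_ , bx) , (My , xy)) = begin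
        suc (2 * D) + suc (length T) * suc (2 * D)
      ≤⟨ +-mono-≤ (bigPart (valid ok) My) (spanned-size ok tree) ⟩
        partSize part (part y) + countB (λ u → spans T (part u))
      ≡⟨ sym (count-∨-disjoint _ _ disjoint (allFin n)) ⟩
        countB (λ u → spans ((x , y) ∷ T) (part u))
      ∎
      where
      open ≤-Reasoning
      disjoint : ∀ u → does (part u ≟ part y) ≡ true → spans T (part u) ≡ false
      disjoint u e = subst (λ p → spans T p ≡ false) (sym (≟-true e)) (fresh (rootEmpty ok) tree (My , xy) bx)

    -- Counting: spanned parts contain more vertices than there are blocked ones.
    admissible : ∀ {M T} → Ok M → IsTree M T → Σ (Fin n) (Admissible T)
    admissible {T = T} ok tree = pigeonhole _ (blocked T) (allFin n) (begin-strict
        countB (blocked T)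
      ≤⟨ blocked-count T ⟩
        suc (length T) * (2 * D)
      <⟨ *-monoʳ-< (suc (length T)) (n<1+n (2 * D)) ⟩
        suc (length T) * suc (2 * D)
      ≤⟨ spanned-size ok tree ⟩
        countB (λ u → spans T (part u))
      ∎)
      where open ≤-Reasoning

    -- The same count bounds the height of every tree.
    tree-short : ∀ {M T} → Ok M → IsTree M T → suc (length T) ≤ n
    tree-short {T = T} ok tree =
      ≤-trans (m≤m*n (suc (length T)) (suc (2 * D))) (≤-trans (spanned-size ok tree) (countB≤ _))

    -- Progress is measured lexicographically by the conflicts of the tree vertices x,
    -- read from the root.  NoWorse Ms M T: no x of T has more conflicts under M than under Ms.
    NoWorse : Choice → Choice → Tree → Set
    NoWorse Ms M []            = ⊤
    NoWorse Ms M ((x , y) ∷ T) = conflicts M x ≤ conflicts Ms x × NoWorse Ms M T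

    Improves : Choice → Choice → Tree → Set
    Improves Ms M []            = ⊥
    Improves Ms M ((x , y) ∷ T) =
      (conflicts M x < conflicts Ms x × IsTree M T × NoWorse Ms M T) ⊎ Improves Ms M T

    NoWorse-refl : ∀ M T → NoWorse M M T
    NoWorse-refl M []            = tt
    NoWorse-refl M ((x , y) ∷ T) = ≤-refl , NoWorse-refl M T

    NoWorse-trans : ∀ {A B C} T → NoWorse A B T → NoWorse B C T → NoWorse A C T
    NoWorse-trans []            _         _         = tt
    NoWorse-trans ((x , y) ∷ T) (ab , AB) (bc , BC) = ≤-trans bc ab , NoWorse-trans T AB BC

    Improves-trans : ∀ {A B C} T → NoWorse A B T → Improves B C T → Improves A C T
    Improves-trans ((x , y) ∷ T) (ab , AB) (inj₁ (bc , tree , BC)) = inj₁ (<-≤-trans bc ab , tree , NoWorse-trans T AB BC)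
    Improves-trans ((x , y) ∷ T) (ab , AB) (inj₂ BC)               = inj₂ (Improves-trans T AB BC)

    Outcome : Choice → Tree → Set
    Outcome Ms T = Done ⊎ Σ Choice λ M → Ok M × Improves Ms M T

    outcome-trans : ∀ {A B} T → NoWorse A B T → Outcome B T → Outcome A T
    outcome-trans T _  (inj₁ done)          = inj₁ done
    outcome-trans T AB (inj₂ (M , ok , BM)) = inj₂ (M , ok , Improves-trans T AB BM)

    assign-tree : ∀ {M q x} T → IsTree M T → spans T q ≡ false → IsTree (assign M q x) T
    assign-tree []                         _                             _ = tt
    assign-tree {M} {q} {x} ((a , b) ∷ T) (tree , adm , (Mb , ab)) s =
      assign-tree T tree (∨-conicalʳ _ _ s) , adm , (trans (assign-other b∉q) Mb , ab)
      where
      b∉q : part b ≢ q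
      b∉q b∈q = true≢false (trans (sym (dec-true (q ≟ part b) (sym b∈q))) (∨-conicalˡ _ _ s))

    assign-noWorse : ∀ {M q x} T → blocked T x ≡ false → NoWorse M (assign M q x) T
    assign-noWorse []            _  = tt
    assign-noWorse ((a , b) ∷ T) bx =
      count-mono (assign-⊆ (blocked-x a b T bx)) (allFin k) , assign-noWorse T (blocked-below a b T bx)

    -- Replacing the blocking vertex y of an edge (a , y) by an admissible free vertex x of the
    -- same part removes a conflict of a, while the older part of the tree is untouched.
    replace-improves : ∀ {M} T {x} → M r ≡ nothing → IsTree M T → Admissible T x → part x ≢ r →
                       Improves M (assign M (part x) x) T
    replace-improves [] _ _ (s , _) x∉r = ⊥-elim (x∉r (≟-true s))
    replace-improves {M} ((a , b) ∷ T) {x} Mr (tree , (_ , ba) , (Mb , ab)) (s , bx) x∉r with part x ≟ part b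
    ... | yes same = inj₁ (fewer , assign-tree T tree unspanned , assign-noWorse T (blocked-below a b T bx))
      where
      unspanned : spans T (part x) ≡ false
      unspanned = subst (λ p → spans T p ≡ false) (sym same) (fresh Mr tree (Mb , ab) ba)
      fewer : conflicts (assign M (part x) x) a < conflicts M a
      fewer = count-mono-< (assign-⊆ (blocked-x a b T bx)) (allFin k) (part x) (∈-allFin (part x))
                (subst (λ o → adjTo a o ≡ false) (sym (assign-at {M} {part x})) (blocked-x a b T bx))
                (subst (λ o → adjTo a o ≡ true) (sym (trans (cong M same) Mb)) ab)
    ... | no _ = inj₂ (replace-improves T Mr tree (s , blocked-below a b T bx) x∉r)

    place : ∀ {M} T {x} → Ok M → IsTree M T → Admissible T x → Free M x → Outcome M T
    place {M} T {x} ok tree adm@(s , bx) free with part x ≟ r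
    ... | yes x∈r = inj₁ (assign M r x , valid′ , (x , assign-at {M} {r}) , λ q f → assign-extends q (extends ok q f))
      where
      valid′ = assign-valid (valid ok) free (blocked-forbidden T bx) x∈r bigr
    ... | no x∉r = inj₂ (assign M (part x) x , ok′ , replace-improves T (rootEmpty ok) tree adm x∉r)
      where
      ok′ : Ok (assign M (part x) x)
      ok′ = record
        { valid     = assign-valid (valid ok) free (blocked-forbidden T bx) refl (spanned-big (valid ok) tree s)
        ; rootEmpty = trans (assign-other (λ r≡x → x∉r (sym r≡x))) (rootEmpty ok)
        ; extends   = λ q f → assign-extends q (extends ok q f)
        }

    -- The search.  The height budget d satisfies n ≤ d + length T; since trees have fewer
    -- than n edges it never runs out.
    mutual
      step : ∀ d T M → Ok M → IsTree M T → n ≤ d + length T → Outcome M T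
      step d T M ok tree h with admissible ok tree
      ... | x , adm with blocker (valid ok) x
      ...   | inj₂ free    = place T ok tree adm free
      ...   | inj₁ (y , bl) = grow d x y T M ok (tree , adm , bl) h

      grow : ∀ d x y T M → Ok M → IsTree M ((x , y) ∷ T) → n ≤ d + length T → Outcome M T
      grow zero    x y T M ok tree h = ⊥-elim (1+n≰n (≤-trans (n≤1+n _) (≤-trans (tree-short ok tree) h)))
      grow (suc d) x y T M ok tree h =
        explore d (suc (conflicts M x)) x y T M M ok tree (NoWorse-refl M T) ≤-refl
          (subst (n ≤_) (sym (+-suc d (length T))) h)

      -- The edge (x , y) sits on top of T, Ms is the state in which x was added, and f bounds
      -- the conflicts of x.  Search above the edge until success, an improvement below the
      -- edge, or (finitely often) an improvement at the edge itself.
      explore : ∀ d f x y T Ms M → Ok M → IsTree M ((x , y) ∷ T) → NoWorse Ms M T →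
                conflicts M x < f → n ≤ d + length ((x , y) ∷ T) → Outcome Ms T
      explore d (suc f) x y T Ms M ok tree@(_ , adm , _) nw lt h =
        resume d f x {y} T Ms M adm nw lt h (step d ((x , y) ∷ T) M ok tree h)

      -- An improvement at the edge itself lowers the conflicts of x: find x's new blocker
      -- (or place x if it became free) and explore again.
      resume : ∀ d f x {y} T Ms M → Admissible T x → NoWorse Ms M T → conflicts M x < suc f →
               n ≤ d + length ((x , y) ∷ T) → Outcome M ((x , y) ∷ T) → Outcome Ms T
      resume d f x T Ms M _ nw _ _ (inj₁ done) = inj₁ done
      resume d f x T Ms M _ nw _ _ (inj₂ (M′ , ok′ , inj₂ better)) = inj₂ (M′ , ok′ , Improves-trans T nw better)
      resume d f x T Ms M adm nw lt h (inj₂ (M′ , ok′ , inj₁ (fewer , below′ , nw′))) with blocker (valid ok′) x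
      ... | inj₁ (y′ , bl) = explore d f x y′ T Ms M′ ok′ (below′ , adm , bl) (NoWorse-trans T nw nw′)
                               (<-≤-trans fewer (≤-pred lt)) h
      ... | inj₂ free      = outcome-trans T (NoWorse-trans T nw nw′) (place T ok′ below′ adm free)

    -- From the empty tree the search succeeds, as nothing can be improved below the root.
    complete : Ok M0 → Done
    complete ok with step n [] M0 ok tt (≤-reflexive (sym (+-identityʳ n)))
    ... | inj₁ done          = done
    ... | inj₂ (_ , _ , ())

  empty-valid : Valid (λ _ → nothing)
  empty-valid = record { inPart = λ () ; independent = λ () ; allowed = λ () ; bigPart = λ () }

  cover : ∀ {j} (ι : Fin j → Fin k) → (∀ a → Big (ι a)) → Σ Choice λ M → Valid M × (∀ a → Filled M (ι a))
  cover {zero}  ι big = (λ _ → nothing) , empty-valid , λ ()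
  cover {suc j} ι big with cover (λ a → ι (suc a)) (λ a → big (suc a))
  ... | M , V , covered with M (ι zero) in Mι
  ...   | just u  = M , V , λ { zero → u , Mι ; (suc a) → covered a }
  ...   | nothing with Extend.complete (ι zero) (big zero) M
                         (record { valid = V ; rootEmpty = Mι ; extends = λ _ filled → filled })
  ...     | M′ , V′ , filled , extends = M′ , V′ , λ { zero → filled ; (suc a) → extends _ (covered a) }

independent-transversal-avoiding :
  ∀ {n k j} (G : Graph n) (part : Fin n → Fin k) (ι : Fin j → Fin k) (forbidden : Fin n → Bool) →
  countB forbidden ≤ 2 * Δ G → (∀ a → 2 * Δ G < partSize part (ι a)) →
  Σ (Fin j → Fin n) λ t → IsIndependentTransversal G part ι t × (∀ a → forbidden (t a) ≡ false)
independent-transversal-avoiding {n} {k} {j} G part ι forbidden few big =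
  t , ((λ a → inPart (chosen a)) , λ a b → independent (chosen a) (chosen b)) , λ a → allowed (chosen a)
  where
  open Haxell G part forbidden few
  covering : Σ Choice λ M → Valid M × (∀ a → Filled M (ι a))
  covering = cover ι big
  open Valid (proj₁ (proj₂ covering))
  t : Fin j → Fin n
  t a = proj₁ (proj₂ (proj₂ covering) a)
  chosen : ∀ a → proj₁ covering (ι a) ≡ just (t a)
  chosen a = proj₂ (proj₂ (proj₂ covering) a)

extend-view : ∀ {n m} (t : Fin m → Fin n) w (i : Fin (suc m)) →
  (Σ (Fin m) λ a → i ≡ inject₁ a × extend t w i ≡ t a) ⊎ (i ≡ fromℕ m × extend t w i ≡ w)
extend-view {m = zero}  t w zero    = inj₂ (refl , refl)
extend-view {m = suc m} t w zero    = inj₁ (zero , refl , refl)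
extend-view {m = suc m} t w (suc i) with extend-view (λ a → t (suc a)) w i
... | inj₁ (a , i≡a , e) = inj₁ (suc a , cong suc i≡a , e)
... | inj₂ (i≡last , e)  = inj₂ (cong suc i≡last , e)

extend-transversal : ∀ {n m} (G : Graph n) (part : Fin n → Fin (suc m)) {t : Fin m → Fin n} {w : Fin n} →
  IsIndependentTransversal G part inject₁ t → part w ≡ fromℕ m → (∀ a → adj G w (t a) ≡ false) →
  IsIndependentTransversal G part (λ i → i) (extend t w)
extend-transversal G part {t} {w} (transversal , independent) w∈last w-free = transversal′ , independent′
  where
  transversal′ : ∀ i → part (extend t w i) ≡ i
  transversal′ i with extend-view t w i
  ... | inj₁ (a , i≡a , e)  rewrite e = trans (transversal a) (sym i≡a)
  ... | inj₂ (i≡last , e)   rewrite e = trans w∈last (sym i≡last)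
  independent′ : ∀ i j → adj G (extend t w i) (extend t w j) ≡ false
  independent′ i j with extend-view t w i | extend-view t w j
  ... | inj₁ (a , _ , e) | inj₁ (b , _ , e′) rewrite e | e′ = independent a b
  ... | inj₁ (a , _ , e) | inj₂ (_ , e′)     rewrite e | e′ = trans (Graph.sym G (t a) w) (w-free a)
  ... | inj₂ (_ , e)     | inj₁ (b , _ , e′) rewrite e | e′ = w-free b
  ... | inj₂ (_ , e)     | inj₂ (_ , e′)     rewrite e | e′ = irrefl G w

two-neighbourhoods : ∀ {n} (G : Graph n) (v v′ : Fin n) → countB (λ u → adj G v u ∨ adj G v′ u) ≤ 2 * Δ G
two-neighbourhoods {n} G v v′ = begin
    countB (λ u → adj G v u ∨ adj G v′ u)
  ≤⟨ count-∨ (adj G v) (adj G v′) (allFin n) ⟩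
    degree G v + degree G v′
  ≤⟨ +-mono-≤ (degree≤Δ G v) (degree≤Δ G v′) ⟩
    Δ G + Δ G
  ≡⟨ cong (Δ G +_) (sym (+-identityʳ (Δ G))) ⟩
    2 * Δ G
  ∎
  where open ≤-Reasoning

lemma2p1 : ∀ {n m : ℕ} (G : Graph n) (part : Fin n → Fin (suc m)) →
    (∀ (i : Fin m) → 2 * Δ G < partSize part (inject₁ i)) →
    ∀ (v v′ : Fin n) → part v ≡ fromℕ m → part v′ ≡ fromℕ m →
    Σ (Fin m → Fin n) (λ t →
      IsIndependentTransversal G part inject₁ t
      × IsIndependentTransversal G part (λ i → i) (extend t v)
      × IsIndependentTransversal G part (λ i → i) (extend t v′))
lemma2p1 G part big v v′ v∈last v′∈last
  with t , it , avoids ← independent-transversal-avoiding G part inject₁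
                           (λ u → adj G v u ∨ adj G v′ u) (two-neighbourhoods G v v′) big =
  t , it , extend-transversal G part it v∈last (λ a → ∨-conicalˡ _ _ (avoids a))
         , extend-transversal G part it v′∈last (λ a → ∨-conicalʳ _ _ (avoids a))
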